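{- For every $n\in\mathbb{N}$ the graph $G(3,n)$ has a Hamiltonian path, and for every even $n>2$ the graph $G(3,n)$ is Hamiltonian (has a Hamiltonian cycle).
   Context: For a prime $p$ and $n\in\mathbb{N}$, $G(p,n)$ is the simple graph with vertex set $\{2,4,\ldots,2n\}$ in which two distinct vertices $a,b$ are adjacent if and only if both $\frac{a+b}{2}$ and $\frac{|a-b|}{2}$ are odd positive integers neither of which equals $pk$ for an integer $k\ge 2$. -}

module Defs where

open import Data.Nat using (ℕ; zero; suc; _+_; _*_; _≤_; _<_; ∣_-_∣; _%_; _/_)
open import Data.Nat.Primality using (Prime)
open import Data.Fin using (Fin; toℕ)
open import Data.List using (List; []; _∷_; _++_; [_])
open import Data.List.Membership.Propositional using (_∈_)
open import Data.List.Relation.Unary.Unique.Propositional using (Unique)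
open import Data.List.Relation.Unary.Linked using (Linked)
open import Data.Product using (Σ; _×_; ∃; ∃-syntax)
open import Relation.Binary.PropositionalEquality using (_≡_; _≢_)
open import Relation.Nullary using (¬_)

Odd : ℕ → Set
Odd m = m % 2 ≡ 1

MultipleAtLeast2 : ℕ → ℕ → Set
MultipleAtLeast2 p m = ∃[ k ] (2 ≤ k × m ≡ p * k)

Allowed : ℕ → ℕ → Set
Allowed p m = Odd m × 0 < m × ¬ MultipleAtLeast2 p m

AdjVal : ℕ → ℕ → ℕ → Set
AdjVal p a b = a ≢ b × Allowed p ((a + b) / 2) × Allowed p (∣ a - b ∣ / 2)

-- vertex i : Fin n of G(p,n) stands for the number 2(i+1) ∈ {2,4,…,2n}
vertexVal : {n : ℕ} → Fin n → ℕ
vertexVal i = 2 * suc (toℕ i)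

Adj : (p n : ℕ) → Fin n → Fin n → Set
Adj p n i j = AdjVal p (vertexVal i) (vertexVal j)

IsHamiltonianPath : (p n : ℕ) → List (Fin n) → Set
IsHamiltonianPath p n l = Unique l × (∀ v → v ∈ l) × Linked (Adj p n) l

HasHamiltonianPath : (p n : ℕ) → Set
HasHamiltonianPath p n = Σ (List (Fin n)) (IsHamiltonianPath p n)

IsHamiltonian : (p n : ℕ) → Set
IsHamiltonian p n =
  Σ (Fin n) λ x → Σ (List (Fin n)) λ xs →
    IsHamiltonianPath p n (x ∷ xs) × Linked (Adj p n) ((x ∷ xs) ++ [ x ])

{-# OPTIONS --safe #-}

-- Number the vertex 2i of G(3, n) by i. Then i ~ j iff i + j and |i - j| are odd and prime to 3,
-- except that a sum or difference equal to 3 is allowed too. Apart from the edge 1 ~ 2 this depends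
-- only on i + j mod 6 and on i - j, so edges survive translating both ends by 6.
-- Call a Hamiltonian path of {1, …, n} a hairpin if it climbs from a to a turn edge x ~ y and then
-- descends to b. Splicing a suitable path on n+1, …, n+12 into the turn gives a hairpin of
-- {1, …, n+12} with turn x+12 ~ y+12 and the same ends a, b; the spliced block translated by 12
-- fits the new turn, so the splicing repeats forever. Twelve base hairpins, for n = 3, …, 14, give
-- Hamiltonian paths for every n ≥ 3; for the six even bases moreover b ~ a, which closes the path
-- into a Hamiltonian cycle.
module Submission where

open import Defs
open import Data.Fin using (Fin; toℕ)
open import Data.List as List using (List; []; _∷_; _++_; allFin; tabulate)
open import Data.List.NonEmpty using (List⁺; _∷_; head; toList)
open import Data.List.Properties using (map-++; map-tabulate; tabulate-cong; ++-assoc; ≡-dec)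
open import Data.List.Membership.Propositional using (_∈_)
open import Data.List.Membership.Propositional.Properties using (∈-allFin)
open import Data.List.Relation.Binary.Permutation.Propositional
  using (_↭_; ↭-refl; ↭-sym; ↭⇒↭ₛ; module PermutationReasoning)
open import Data.List.Relation.Binary.Permutation.Propositional.Properties
  using (∈-resp-↭; ↭-map-inv; ++⁺ˡ; ++⁺; ++-comm; map⁺)
import Data.List.Relation.Binary.Permutation.Setoid.Properties as PermutationₛProperties
open import Data.List.Relation.Unary.Linked as Linked using (Linked; []; [-]; _∷_; linked?)
open import Data.List.Relation.Unary.Linked.Properties using (map⁻)
open import Data.List.Relation.Unary.Unique.Propositional using (Unique)
open import Data.List.Relation.Unary.Unique.Propositional.Properties using (allFin⁺)
open import Data.Nat using (ℕ; zero; suc; _+_; _*_; _≤_; _<_; s≤s; _%_; _/_; ∣_-_∣; _≟_; _<?_; _≤?_)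
open import Data.Nat.Properties
open import Algebra.Properties.CommutativeSemigroup +-commutativeSemigroup using (x∙yz≈y∙xz)
open import Data.List.Sort.InsertionSort ≤-decTotalOrder using (sort)
open import Data.List.Sort.InsertionSort.Properties ≤-decTotalOrder using (sort-↭)
open import Data.Nat.DivMod using (m*n/n≡m; m*n%n≡0; m∣n⇒o%n%m≡o%m)
open import Data.Nat.Divisibility using (_∣_; _∣?_; divides; n∣m⇒m%n≡0; _∣0)
open import Data.Product using (_×_; _,_; ∃-syntax; proj₁; proj₂)
open import Data.Sum using (_⊎_; inj₁; inj₂)
open import Function using (_∘_; _$_; id)
open import Level using (0ℓ)
open import Relation.Binary.Core using (Rel; _⇒_)
open import Relation.Binary.Definitions using (Decidable)
open import Relation.Binary.PropositionalEquality
  using (_≡_; _≢_; refl; sym; trans; cong; cong₂; subst; setoid)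
open import Relation.Nullary using (¬_; Dec)
open import Relation.Nullary.Decidable using (True; toWitness; _×-dec_; _⊎-dec_; ¬?; map′)

half-double : ∀ k → 2 * k / 2 ≡ k
half-double k = trans (cong (_/ 2) (*-comm 2 k)) (m*n/n≡m k 2)

double%2≡0 : ∀ k → 2 * k % 2 ≡ 0
double%2≡0 k = trans (cong (_% 2) (*-comm 2 k)) (m*n%n≡0 k 2)

multipleAtLeast2⇒ : ∀ {m} → MultipleAtLeast2 3 m → 3 ∣ m × 6 ≤ m
multipleAtLeast2⇒ (k , 2≤k , refl) = divides k (*-comm 3 k) , *-monoʳ-≤ 3 2≤k

multipleAtLeast2⇐ : ∀ {m} → 3 ∣ m × 6 ≤ m → MultipleAtLeast2 3 m
multipleAtLeast2⇐ (divides k refl , 6≤3k) = k , *-cancelʳ-≤ 2 k 3 6≤3k , *-comm k 3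

multipleAtLeast2? : ∀ m → Dec (MultipleAtLeast2 3 m)
multipleAtLeast2? m = map′ multipleAtLeast2⇐ multipleAtLeast2⇒ (3 ∣? m ×-dec 6 ≤? m)

allowed? : ∀ m → Dec (Allowed 3 m)
allowed? m = m % 2 ≟ 1 ×-dec 0 <? m ×-dec ¬? (multipleAtLeast2? m)

CoprimeTo6 : ℕ → Set
CoprimeTo6 m = m % 6 ≡ 1 ⊎ m % 6 ≡ 5

%6%2≡%2 : ∀ m → m % 6 % 2 ≡ m % 2
%6%2≡%2 m = m∣n⇒o%n%m≡o%m 2 6 m (divides 3 refl)

%6%3≡%3 : ∀ m → m % 6 % 3 ≡ m % 3
%6%3≡%3 m = m∣n⇒o%n%m≡o%m 3 6 m (divides 2 refl)

coprimeTo6⇒odd : ∀ {m} → CoprimeTo6 m → Odd m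
coprimeTo6⇒odd {m} (inj₁ m%6≡1) = trans (sym (%6%2≡%2 m)) (cong (_% 2) m%6≡1)
coprimeTo6⇒odd {m} (inj₂ m%6≡5) = trans (sym (%6%2≡%2 m)) (cong (_% 2) m%6≡5)

coprimeTo6⇒∤3 : ∀ {m} → CoprimeTo6 m → ¬ 3 ∣ m
coprimeTo6⇒∤3 {m} c 3∣m = residue≢0 c (trans (%6%3≡%3 m) (n∣m⇒m%n≡0 m 3 3∣m))
  where
  residue≢0 : CoprimeTo6 m → m % 6 % 3 ≢ 0
  residue≢0 (inj₁ m%6≡1) rewrite m%6≡1 = λ ()
  residue≢0 (inj₂ m%6≡5) rewrite m%6≡5 = λ ()

coprimeTo6⇒allowed : ∀ {m} → CoprimeTo6 m → Allowed 3 m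
coprimeTo6⇒allowed {m} c =
  coprimeTo6⇒odd {m} c ,
  n≢0⇒n>0 (λ { refl → coprimeTo6⇒∤3 {m} c (3 ∣0) }) ,
  λ (k , _ , m≡3k) → coprimeTo6⇒∤3 {m} c (divides k (trans m≡3k (*-comm 3 k)))

infix 4 _~_ _~₆_

-- A record rather than a definition, so that i and j can be inferred from the type of a proof.
record _~_ (i j : ℕ) : Set where
  constructor adjacent
  field
    doubles-adjacent : AdjVal 3 (2 * i) (2 * j)

open _~_ using (doubles-adjacent)

_~?_ : Decidable _~_
i ~? j = map′ adjacent doubles-adjacent (¬? (2 * i ≟ 2 * j) ×-dec allowed? _ ×-dec allowed? _)

vertex : ∀ {n} → Fin n → ℕ
vertex i = suc (toℕ i)

-- Adjacency without the exceptional edge 1 ~ 2; unlike _~_ it is invariant under translation by 6.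
record _~₆_ (i j : ℕ) : Set where
  constructor adjacent₆
  field
    coprime-sum : CoprimeTo6 (i + j)
    allowed-difference : Allowed 3 ∣ i - j ∣

_~₆?_ : Decidable _~₆_
i ~₆? j = map′ (λ (c , d) → adjacent₆ c d) (λ (adjacent₆ c d) → c , d)
               ((((i + j) % 6 ≟ 1) ⊎-dec ((i + j) % 6 ≟ 5)) ×-dec allowed? ∣ i - j ∣)

~₆⇒~ : ∀ {i j} → i ~₆ j → i ~ j
~₆⇒~ {i} {j} (adjacent₆ i+j-coprime ∣i-j∣-allowed) = adjacent $
  2i≢2j ,
  subst (Allowed 3) (sym half-sum) (coprimeTo6⇒allowed {i + j} i+j-coprime) ,
  subst (Allowed 3) (sym half-difference) ∣i-j∣-allowed
  where
  half-sum : (2 * i + 2 * j) / 2 ≡ i + j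
  half-sum = trans (cong (_/ 2) (sym (*-distribˡ-+ 2 i j))) (half-double (i + j))
  half-difference : ∣ 2 * i - 2 * j ∣ / 2 ≡ ∣ i - j ∣
  half-difference = trans (cong (_/ 2) (sym (*-distribˡ-∣-∣ 2 i j))) (half-double ∣ i - j ∣)
  2i≢2j : 2 * i ≢ 2 * j
  2i≢2j 2i≡2j = <-irrefl (sym (m≡n⇒∣m-n∣≡0 (*-cancelˡ-≡ i j 2 2i≡2j))) (proj₁ (proj₂ ∣i-j∣-allowed))

~₆-translate : ∀ {i j} → i ~₆ j → 6 + i ~₆ 6 + j
~₆-translate {i} {j} (adjacent₆ i+j-coprime ∣i-j∣-allowed) =
  adjacent₆ (subst (CoprimeTo6 ∘ (6 +_)) (sym (x∙yz≈y∙xz i 6 j)) i+j-coprime) ∣i-j∣-allowed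

infixr 5 _◅_

data Path {A : Set} (R : Rel A 0ℓ) : A → List A → A → Set where
  [_] : ∀ x → Path R x (x ∷ []) x
  _◅_ : ∀ {x y z ys} → R x y → Path R y ys z → Path R x (x ∷ ys) z

module _ {A : Set} {R : Rel A 0ℓ} where

  infixr 4 _++⟨_⟩_

  _++⟨_⟩_ : ∀ {x y z w xs zs} → Path R x xs y → R y z → Path R z zs w → Path R x (xs ++ zs) w
  [ _ ]    ++⟨ r ⟩ q = r ◅ q
  (r′ ◅ p) ++⟨ r ⟩ q = r′ ◅ (p ++⟨ r ⟩ q)

  map : ∀ {S : Rel A 0ℓ} {x xs y} → R ⇒ S → Path R x xs y → Path S x xs y
  map f [ x ]   = [ x ]
  map f (r ◅ p) = f r ◅ map f p

  gmap : ∀ {B : Set} {S : Rel B 0ℓ} (f : A → B) {x xs y} →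
         (∀ {u v} → R u v → S (f u) (f v)) → Path R x xs y → Path S (f x) (List.map f xs) (f y)
  gmap f g [ x ]   = [ f x ]
  gmap f g (r ◅ p) = g r ◅ gmap f g p

  linked : ∀ {x xs y} → Path R x xs y → Linked R xs
  linked [ _ ]           = [-]
  linked (r ◅ p@([ _ ])) = r ∷ linked p
  linked (r ◅ p@(_ ◅ _)) = r ∷ linked p

  source≡head : ∀ {x y ys z} → Path R x (y ∷ ys) z → x ≡ y
  source≡head [ _ ]   = refl
  source≡head (_ ◅ _) = refl

  -- Data.List.NonEmpty.last goes through a snoc view and does not unfold along the list.
  last : List⁺ A → A
  last (x ∷ xs) = List.foldl (λ _ y → y) x xs

  linked⇒path : ∀ xs → Linked R (toList xs) → Path R (head xs) (toList xs) (last xs)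
  linked⇒path (x ∷ [])     [-]      = [ x ]
  linked⇒path (x ∷ y ∷ ys) (r ∷ rs) = r ◅ linked⇒path (y ∷ ys) rs

  path : (R? : Decidable R) → ∀ xs → {True (linked? R? (toList xs))} →
         Path R (head xs) (toList xs) (last xs)
  path R? xs {ok} = linked⇒path xs (toWitness ok)

  edge : (R? : Decidable R) → ∀ {x y} {ok : True (R? x y)} → R x y
  edge R? {ok = ok} = toWitness ok

interval : ℕ → ℕ → List ℕ
interval k zero    = []
interval k (suc n) = suc k ∷ interval (suc k) n

interval-++ : ∀ k n m → interval k n ++ interval (k + n) m ≡ interval k (n + m)
interval-++ k zero    m rewrite +-identityʳ k = refl
interval-++ k (suc n) m rewrite +-suc k n = cong (suc k ∷_) (interval-++ (suc k) n m)

map-+-interval : ∀ d k n → List.map (d +_) (interval k n) ≡ interval (d + k) n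
map-+-interval d k zero    = refl
map-+-interval d k (suc n) =
  cong₂ _∷_ (+-suc d k) (trans (map-+-interval d (suc k) n) (cong (λ k′ → interval k′ n) (+-suc d k)))

tabulate-interval : ∀ k n → tabulate {n = n} (λ i → k + vertex i) ≡ interval k n
tabulate-interval k zero    = refl
tabulate-interval k (suc n) rewrite +-comm k 1 =
  cong (suc k ∷_) (trans (tabulate-cong (λ i → +-suc k (vertex i))) (tabulate-interval (suc k) n))

vertices-interval : ∀ n → List.map vertex (allFin n) ≡ interval 0 n
vertices-interval n = trans (map-tabulate id vertex) (tabulate-interval 0 n)

↭-sort : ∀ {xs ys} → {True (≡-dec _≟_ (sort xs) ys)} → xs ↭ ys
↭-sort {xs} {ys} {sorted} = subst (xs ↭_) (toWitness sorted) (↭-sym (sort-↭ xs))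

↭-swap-middle : ∀ {A : Set} (as bs cs ds : List A) → (as ++ bs) ++ (cs ++ ds) ↭ (as ++ ds) ++ (bs ++ cs)
↭-swap-middle as bs cs ds = begin
  (as ++ bs) ++ (cs ++ ds) ≡⟨ ++-assoc as bs (cs ++ ds) ⟩
  as ++ bs ++ cs ++ ds     ≡⟨ cong (as ++_) (sym (++-assoc bs cs ds)) ⟩
  as ++ (bs ++ cs) ++ ds   ↭⟨ ++⁺ˡ as (++-comm (bs ++ cs) ds) ⟩
  as ++ ds ++ bs ++ cs     ≡⟨ sym (++-assoc as ds (bs ++ cs)) ⟩
  (as ++ ds) ++ (bs ++ cs) ∎
  where open PermutationReasoning

module _ {n : ℕ} where

  enumerate-vertices : ∀ {xs} → xs ↭ interval 0 n →
                ∃[ vs ] xs ≡ List.map vertex vs × Unique vs × (∀ v → v ∈ vs)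
  enumerate-vertices σ
    with vs , xs≡vs , allFin↭vs ← ↭-map-inv vertex (subst (_↭ _) (sym (vertices-interval n)) (↭-sym σ)) =
    vs , xs≡vs ,
    PermutationₛProperties.Unique-resp-↭ (setoid (Fin n)) (↭⇒↭ₛ allFin↭vs) (allFin⁺ n) ,
    λ v → ∈-resp-↭ allFin↭vs (∈-allFin v)

  linked-vertices : ∀ {vs} → Linked _~_ (List.map vertex vs) → Linked (Adj 3 n) vs
  linked-vertices = Linked.map doubles-adjacent ∘ map⁻

  hasHamiltonianPath : ∀ {xs} → Linked _~_ xs → xs ↭ interval 0 n → HasHamiltonianPath 3 n
  hasHamiltonianPath lk σ with vs , refl , unique , complete ← enumerate-vertices σ =
    vs , unique , complete , linked-vertices lk

  isHamiltonian : ∀ {a xs b} → Path _~_ a xs b → b ~ a → xs ↭ interval 0 n → IsHamiltonian 3 n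
  isHamiltonian {a} {_} {b} a⋯b b~a σ with vs , refl , unique , complete ← enumerate-vertices σ =
    close vs a⋯b unique complete
    where
    close : ∀ vs → Path _~_ a (List.map vertex vs) b → Unique vs → (∀ v → v ∈ vs) → IsHamiltonian 3 n
    close (v ∷ vs) a⋯b unique complete =
      v , vs , (unique , complete , linked-vertices (linked a⋯b)) ,
      linked-vertices (subst (Linked _~_) (sym (map-++ vertex (v ∷ vs) (v ∷ [])))
                             (linked (a⋯b ++⟨ subst (b ~_) (source≡head a⋯b) b~a ⟩ [ vertex v ])))

data Hairpin (a b n x y : ℕ) : Set where
  hairpin : ∀ {us ds} → Path _~_ a us x → x ~₆ y → Path _~_ y ds b → us ++ ds ↭ interval 0 n →
            Hairpin a b n x y

data Block (n x y : ℕ) : Set where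
  block : ∀ {u us ds d} → x ~₆ u → Path _~₆_ u us (12 + x) → Path _~₆_ (12 + y) ds d → d ~₆ y →
          us ++ ds ↭ interval n 12 → Block n x y

extend : ∀ {a b n x y} → Hairpin a b n x y → Block n x y → Hairpin a b (12 + n) (12 + x) (12 + y)
extend {n = n} (hairpin {us} {ds} a⋯x x~y y⋯b σ) (block {us = us′} {ds′} x~u u⋯x′ y′⋯d d~y τ) =
  hairpin (a⋯x ++⟨ ~₆⇒~ x~u ⟩ map ~₆⇒~ u⋯x′)
          (~₆-translate (~₆-translate x~y))
          (map ~₆⇒~ y′⋯d ++⟨ ~₆⇒~ d~y ⟩ y⋯b)
          (begin
            (us ++ us′) ++ (ds′ ++ ds) ↭⟨ ↭-swap-middle us us′ ds′ ds ⟩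
            (us ++ ds) ++ (us′ ++ ds′) ↭⟨ ++⁺ σ τ ⟩
            interval 0 n ++ interval n 12 ≡⟨ interval-++ 0 n 12 ⟩
            interval 0 (n + 12) ≡⟨ cong (interval 0) (+-comm n 12) ⟩
            interval 0 (12 + n) ∎)
  where open PermutationReasoning

shift : ∀ {n x y} → Block n x y → Block (12 + n) (12 + x) (12 + y)
shift {n} (block {us = us} {ds} x~u u⋯x′ y′⋯d d~y τ) =
  block (translate x~u) (gmap (12 +_) translate u⋯x′) (gmap (12 +_) translate y′⋯d) (translate d~y)
        (begin
          List.map (12 +_) us ++ List.map (12 +_) ds ≡⟨ sym (map-++ (12 +_) us ds) ⟩
          List.map (12 +_) (us ++ ds) ↭⟨ map⁺ (12 +_) τ ⟩
          List.map (12 +_) (interval n 12) ≡⟨ map-+-interval 12 n 12 ⟩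
          interval (12 + n) 12 ∎)
  where
  open PermutationReasoning
  translate : ∀ {i j} → i ~₆ j → 12 + i ~₆ 12 + j
  translate = ~₆-translate ∘ ~₆-translate

data Ladder (n : ℕ) : Set where
  ladder : ∀ {a b x y} → Hairpin a b n x y → Block n x y → (n % 2 ≡ 0 → b ~ a) → Ladder n

-- (12 + n) % 2 reduces to n % 2, so the closing edge carries over unchanged.
climb : ∀ {n} → Ladder n → Ladder (12 + n)
climb (ladder h B closing) = ladder (extend h B) (shift B) closing

ladder⇒path : ∀ {n} → Ladder n → HasHamiltonianPath 3 n
ladder⇒path (ladder (hairpin a⋯x x~y y⋯b σ) _ _) = hasHamiltonianPath (linked (a⋯x ++⟨ ~₆⇒~ x~y ⟩ y⋯b)) σ

ladder⇒cycle : ∀ {n} → Ladder n → n % 2 ≡ 0 → IsHamiltonian 3 n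
ladder⇒cycle (ladder (hairpin a⋯x x~y y⋯b σ) _ closing) even =
  isHamiltonian (a⋯x ++⟨ ~₆⇒~ x~y ⟩ y⋯b) (closing even) σ

-- The base cases were found by computer search.
ladders : ∀ m → Ladder (3 + m)
ladders 0 =
  ladder (hairpin (path _~?_ (1 ∷ 2 ∷ [])) (edge _~₆?_) (path _~?_ (3 ∷ [])) ↭-sort)
         (block (edge _~₆?_) (path _~₆?_ (5 ∷ 6 ∷ 7 ∷ 4 ∷ 9 ∷ 10 ∷ 13 ∷ 12 ∷ 11 ∷ 14 ∷ []))
                (path _~₆?_ (15 ∷ 8 ∷ [])) (edge _~₆?_) ↭-sort)
         (λ ())
ladders 1 =
  ladder (hairpin (path _~?_ (1 ∷ [])) (edge _~₆?_) (path _~?_ (4 ∷ 3 ∷ 2 ∷ [])) ↭-sort)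
         (block (edge _~₆?_) (path _~₆?_ (6 ∷ 5 ∷ 8 ∷ 9 ∷ 10 ∷ 13 ∷ []))
                (path _~₆?_ (16 ∷ 15 ∷ 14 ∷ 11 ∷ 12 ∷ 7 ∷ [])) (edge _~₆?_) ↭-sort)
         (λ _ → edge _~?_)
ladders 2 =
  ladder (hairpin (path _~?_ (1 ∷ [])) (edge _~₆?_) (path _~?_ (4 ∷ 3 ∷ 2 ∷ 5 ∷ [])) ↭-sort)
         (block (edge _~₆?_) (path _~₆?_ (6 ∷ 7 ∷ 10 ∷ 9 ∷ 8 ∷ 11 ∷ 14 ∷ 17 ∷ 12 ∷ 13 ∷ []))
                (path _~₆?_ (16 ∷ 15 ∷ [])) (edge _~₆?_) ↭-sort)
         (λ ())
ladders 3 =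
  ladder (hairpin (path _~?_ (1 ∷ [])) (edge _~₆?_) (path _~?_ (4 ∷ 3 ∷ 2 ∷ 5 ∷ 6 ∷ [])) ↭-sort)
         (block (edge _~₆?_) (path _~₆?_ (12 ∷ 7 ∷ 10 ∷ 9 ∷ 8 ∷ 11 ∷ 14 ∷ 17 ∷ 18 ∷ 13 ∷ []))
                (path _~₆?_ (16 ∷ 15 ∷ [])) (edge _~₆?_) ↭-sort)
         (λ _ → edge _~?_)
ladders 4 =
  ladder (hairpin (path _~?_ (1 ∷ [])) (edge _~₆?_) (path _~?_ (4 ∷ 3 ∷ 2 ∷ 5 ∷ 6 ∷ 7 ∷ [])) ↭-sort)
         (block (edge _~₆?_) (path _~₆?_ (12 ∷ 11 ∷ 8 ∷ 9 ∷ 10 ∷ 13 ∷ []))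
                (path _~₆?_ (16 ∷ 19 ∷ 18 ∷ 17 ∷ 14 ∷ 15 ∷ [])) (edge _~₆?_) ↭-sort)
         (λ ())
ladders 5 =
  ladder (hairpin (path _~?_ (1 ∷ [])) (edge _~₆?_) (path _~?_ (4 ∷ 7 ∷ 6 ∷ 5 ∷ 8 ∷ 3 ∷ 2 ∷ [])) ↭-sort)
         (block (edge _~₆?_) (path _~₆?_ (12 ∷ 11 ∷ 14 ∷ 9 ∷ 10 ∷ 13 ∷ []))
                (path _~₆?_ (16 ∷ 19 ∷ 18 ∷ 17 ∷ 20 ∷ 15 ∷ [])) (edge _~₆?_) ↭-sort)
         (λ _ → edge _~?_)
ladders 6 =
  ladder (hairpin (path _~?_ (1 ∷ [])) (edge _~₆?_) (path _~?_ (4 ∷ 3 ∷ 2 ∷ 9 ∷ 8 ∷ 5 ∷ 6 ∷ 7 ∷ [])) ↭-sort)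
         (block (edge _~₆?_) (path _~₆?_ (12 ∷ 11 ∷ 14 ∷ 15 ∷ 10 ∷ 13 ∷ []))
                (path _~₆?_ (16 ∷ 19 ∷ 18 ∷ 17 ∷ 20 ∷ 21 ∷ [])) (edge _~₆?_) ↭-sort)
         (λ ())
ladders 7 =
  ladder (hairpin (path _~?_ (1 ∷ [])) (edge _~₆?_) (path _~?_ (4 ∷ 3 ∷ 2 ∷ 5 ∷ 8 ∷ 9 ∷ 10 ∷ 7 ∷ 6 ∷ [])) ↭-sort)
         (block (edge _~₆?_) (path _~₆?_ (12 ∷ 11 ∷ 14 ∷ 15 ∷ 20 ∷ 17 ∷ 18 ∷ 13 ∷ []))
                (path _~₆?_ (16 ∷ 19 ∷ 22 ∷ 21 ∷ [])) (edge _~₆?_) ↭-sort)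
         (λ _ → edge _~?_)
ladders 8 =
  ladder (hairpin (path _~?_ (1 ∷ [])) (edge _~₆?_) (path _~?_ (4 ∷ 3 ∷ 2 ∷ 5 ∷ 6 ∷ 7 ∷ 10 ∷ 9 ∷ 8 ∷ 11 ∷ [])) ↭-sort)
         (block (edge _~₆?_) (path _~₆?_ (12 ∷ 13 ∷ []))
                (path _~₆?_ (16 ∷ 15 ∷ 14 ∷ 17 ∷ 20 ∷ 23 ∷ 18 ∷ 19 ∷ 22 ∷ 21 ∷ [])) (edge _~₆?_) ↭-sort)
         (λ ())
ladders 9 =
  ladder (hairpin (path _~?_ (1 ∷ [])) (edge _~₆?_) (path _~?_ (4 ∷ 3 ∷ 2 ∷ 5 ∷ 6 ∷ 7 ∷ 10 ∷ 9 ∷ 8 ∷ 11 ∷ 12 ∷ [])) ↭-sort)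
         (block (edge _~₆?_) (path _~₆?_ (18 ∷ 13 ∷ []))
                (path _~₆?_ (16 ∷ 15 ∷ 14 ∷ 17 ∷ 20 ∷ 23 ∷ 24 ∷ 19 ∷ 22 ∷ 21 ∷ [])) (edge _~₆?_) ↭-sort)
         (λ _ → edge _~?_)
ladders 10 =
  ladder (hairpin (path _~?_ (1 ∷ 2 ∷ [])) (edge _~₆?_) (path _~?_ (3 ∷ 4 ∷ 7 ∷ 6 ∷ 5 ∷ 8 ∷ 9 ∷ 10 ∷ 13 ∷ 12 ∷ 11 ∷ [])) ↭-sort)
         (block (edge _~₆?_) (path _~₆?_ (21 ∷ 14 ∷ []))
                (path _~₆?_ (15 ∷ 16 ∷ 19 ∷ 18 ∷ 17 ∷ 20 ∷ 23 ∷ 24 ∷ 25 ∷ 22 ∷ [])) (edge _~₆?_) ↭-sort)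
         (λ ())
ladders 11 =
  ladder (hairpin (path _~?_ (3 ∷ [])) (edge _~₆?_) (path _~?_ (4 ∷ 1 ∷ 2 ∷ 5 ∷ 6 ∷ 7 ∷ 10 ∷ 13 ∷ 12 ∷ 11 ∷ 8 ∷ 9 ∷ 14 ∷ [])) ↭-sort)
         (block (edge _~₆?_) (path _~₆?_ (20 ∷ 15 ∷ []))
                (path _~₆?_ (16 ∷ 19 ∷ 22 ∷ 25 ∷ 18 ∷ 17 ∷ 24 ∷ 23 ∷ 26 ∷ 21 ∷ [])) (edge _~₆?_) ↭-sort)
         (λ _ → edge _~?_)
ladders (suc (suc (suc (suc (suc (suc (suc (suc (suc (suc (suc (suc m)))))))))))) = climb (ladders m)

theorem4p6 : ((n : ℕ) → HasHamiltonianPath 3 n)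
    × ((n : ℕ) → (∃[ m ] n ≡ 2 * m) → 2 < n → IsHamiltonian 3 n)
theorem4p6 = paths , cycles
  where
  paths : (n : ℕ) → HasHamiltonianPath 3 n
  paths 0 = hasHamiltonianPath [] ↭-refl
  paths 1 = hasHamiltonianPath [-] ↭-refl
  paths 2 = hasHamiltonianPath (edge _~?_ ∷ [-]) ↭-refl
  paths (suc (suc (suc m))) = ladder⇒path (ladders m)

  cycles : (n : ℕ) → (∃[ m ] n ≡ 2 * m) → 2 < n → IsHamiltonian 3 n
  cycles 0 _ ()
  cycles 1 _ (s≤s ())
  cycles 2 _ (s≤s (s≤s ()))
  cycles (suc (suc (suc m))) (k , n≡2k) _ =
    ladder⇒cycle (ladders m) (trans (cong (_% 2) n≡2k) (double%2≡0 k))
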